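{- Let $\sigma\in\mathfrak S_n$ and $1\le k\le n$, with the conventions $\eta(\sigma,0)=\eta(\sigma,n)=\sigma$. Let $a_1<\dots<a_m<k$ be the positions such that $(a_i,k)$ is a Bruhat transposition for $\sigma$, and $k<b_1<\dots<b_{m'}$ the positions such that $(k,b_i)$ is a Bruhat transposition for $\sigma$. Then $\eta(\sigma,k)=\eta(\sigma,k-1)\,\rho$, where $\rho$ is the cycle $(a_1,\dots,a_m,k,b_1,\dots,b_{m'})$.
   Context: $\mathfrak S_n$: permutations as words; products are compositions, $(\sigma\mu)(i)=\sigma(\mu(i))$; a cycle $(c_1,\dots,c_r)$ maps $c_1\mapsto c_2\mapsto\cdots\mapsto c_r\mapsto c_1$ and fixes other points; $\ell$ = number of inversions. A transposition $\tau$ is a Bruhat transposition for $\mu$ if $\ell(\mu\tau)=\ell(\mu)+1$. A $k$-transposition is $(a,b)$ with $a\le k<b$. For $1\le k<n$, $W_{\sigma,k}=(\tau_1\prec\cdots\prec\tau_m)$ is the list of all $k$-transpositions that are Bruhat transpositions for $\sigma$, ordered by $(a,b)\prec(a',b')$ iff $\sigma(a)>\sigma(a')$, or $a=a'$ and $\sigma(b)<\sigma(b')$; and $\eta(\sigma,k):=\sigma\tau_1\tau_2\cdots\tau_m$. -}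

module Defs where

-- Positions 1..n of the paper are encoded by Fin n : paper position p ↔ Fin index p-1.
-- Permutations act as functions Fin n → Fin n; the product σμ is σ ∘ μ.

open import Data.Nat as ℕ using (ℕ; zero; suc; _∸_)
open import Data.Fin using (Fin; toℕ; _<_; _<?_; _≟_)
open import Data.Fin.Permutation using (Permutation′; _⟨$⟩ʳ_)
open import Data.List using (List; []; _∷_; filter; length; cartesianProduct; allFin; foldl)
open import Data.Product using (_×_; _,_; proj₁; proj₂)
open import Data.Sum using (_⊎_)
open import Data.Bool using (if_then_else_)
open import Relation.Binary.PropositionalEquality using (_≡_)
open import Relation.Nullary using (Dec; does)
open import Relation.Nullary.Decidable using (_×-dec_; _⊎-dec_)
open import Function using (_∘_)

pairs : ∀ {n} → List (Fin n × Fin n)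
pairs {n} = cartesianProduct (allFin n) (allFin n)

inv : ∀ {n} → (Fin n → Fin n) → ℕ
inv f = length (filter (λ p → (proj₁ p <? proj₂ p) ×-dec (f (proj₂ p) <? f (proj₁ p))) pairs)

transp : ∀ {n} → Fin n → Fin n → Fin n → Fin n
transp a b x = if does (x ≟ a) then b else (if does (x ≟ b) then a else x)

IsBruhat : ∀ {n} → (Fin n → Fin n) → Fin n → Fin n → Set
IsBruhat μ a b = inv (μ ∘ transp a b) ≡ suc (inv μ)

isBruhat? : ∀ {n} (μ : Fin n → Fin n) (a b : Fin n) → Dec (IsBruhat μ a b)
isBruhat? μ a b = inv (μ ∘ transp a b) ℕ.≟ suc (inv μ)

-- (a , b) is a k-transposition (paper positions a+1 ≤ k < b+1), i.e. toℕ a < k ≤ toℕ b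
IsKTransp : ∀ {n} → ℕ → Fin n × Fin n → Set
IsKTransp k (a , b) = toℕ a ℕ.< k × k ℕ.≤ toℕ b

isKTransp? : ∀ {n} (k : ℕ) (p : Fin n × Fin n) → Dec (IsKTransp k p)
isKTransp? k (a , b) = (toℕ a ℕ.<? k) ×-dec (k ℕ.≤? toℕ b)

Prec : ∀ {n} → (Fin n → Fin n) → Fin n × Fin n → Fin n × Fin n → Set
Prec σ (a , b) (a' , b') = (σ a' < σ a) ⊎ ((a ≡ a') × (σ b < σ b'))

prec? : ∀ {n} (σ : Fin n → Fin n) (p q : Fin n × Fin n) → Dec (Prec σ p q)
prec? σ (a , b) (a' , b') = (σ a' <? σ a) ⊎-dec ((a ≟ a') ×-dec (σ b <? σ b'))

-- insertion sort w.r.t. ≺ (a strict total order on k-transpositions for σ a permutation)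
insert≺ : ∀ {n} → (Fin n → Fin n) → Fin n × Fin n → List (Fin n × Fin n) → List (Fin n × Fin n)
insert≺ σ x [] = x ∷ []
insert≺ σ x (y ∷ ys) = if does (prec? σ x y) then x ∷ y ∷ ys else y ∷ insert≺ σ x ys

sort≺ : ∀ {n} → (Fin n → Fin n) → List (Fin n × Fin n) → List (Fin n × Fin n)
sort≺ σ [] = []
sort≺ σ (x ∷ xs) = insert≺ σ x (sort≺ σ xs)

W : ∀ {n} → (Fin n → Fin n) → ℕ → List (Fin n × Fin n)
W σ k = sort≺ σ (filter (λ p → isKTransp? k p ×-dec isBruhat? σ (proj₁ p) (proj₂ p)) pairs)

-- η(σ,k) = σ τ₁ τ₂ ⋯ τ_m  (for k = 0 or k ≥ n the list W is empty, so η(σ,k) = σ,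
-- in accordance with the conventions η(σ,0) = η(σ,n) = σ)
eta : ∀ {n} → (Fin n → Fin n) → ℕ → Fin n → Fin n
eta σ k = foldl (λ f t → f ∘ transp (proj₁ t) (proj₂ t)) σ (W σ k)

-- the cycle (c₁, …, c_r): c₁ ↦ c₂ ↦ ⋯ ↦ c_r ↦ c₁, other points fixed
cycleGo : ∀ {n} → Fin n → List (Fin n) → Fin n → Fin n
cycleGo h [] x = x
cycleGo h (c ∷ []) x = if does (x ≟ c) then h else x
cycleGo h (c ∷ d ∷ cs) x = if does (x ≟ c) then d else cycleGo h (d ∷ cs) x

cycle : ∀ {n} → List (Fin n) → Fin n → Fin n
cycle [] x = x
cycle (c ∷ cs) x = cycleGo c (c ∷ cs) x

module Submission where

-- Both W_{σ,k} and W_{σ,k-1} contain the Bruhat transpositions (a , b) with a < k < b, in the same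
-- ≺-order since both lists are sorted; W_{σ,k} adds the (k , bᵢ) and W_{σ,k-1} the (aᵢ , k).
-- Counting inversions shows that a Bruhat transposition (a , b) has σ(a) < σ(b) and no a < c < b
-- with σ(a) < σ(c) < σ(b). Hence each (k , bᵢ), and each (aᵢ , k), commutes with the common
-- transpositions ≺-after it, the (k , bᵢ) come in decreasing order of bᵢ and the (aᵢ , k) in
-- increasing order of aᵢ. With M the product of the common part this gives
--   η(σ,k) = σ M (k , b_m′) ⋯ (k , b₁)   and   η(σ,k-1) = σ M (a₁ , k) ⋯ (aₘ , k),
-- and it remains to check ρ = (aₘ , k) ⋯ (a₁ , k) (k , b_m′) ⋯ (k , b₁).

open import Defs

open import Data.Nat as ℕ using (ℕ; zero; suc; _+_; _≤_; z≤n; s≤s; _<?_)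
import Data.Nat.Properties as ℕ
open import Algebra.Properties.CommutativeMonoid.Sum ℕ.+-0-commutativeMonoid using (sum; ∑-distrib-+; sum-cong-≗)
open import Algebra.Properties.CommutativeSemigroup ℕ.+-commutativeSemigroup using (x∙yz≈y∙xz; xy∙z≈xz∙y)
open import Data.Bool using (if_then_else_; _∧_)
open import Data.Empty using (⊥; ⊥-elim)
open import Data.Fin as F using (Fin; toℕ; _≟_; _<_)
open import Data.Fin.Permutation using (Permutation′; _⟨$⟩ʳ_)
open import Data.Fin.Properties using (suc-injective; 0≢1+n; <-cmp; <-asym; <-trans; <-irrefl; <⇒≢; ≤∧≢⇒<)
open import Data.List
  using (List; []; _∷_; _++_; [_]; length; filter; map; foldl; reverse; tabulate; allFin; cartesianProduct)
open import Data.List.Properties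
  using (filter-accept; filter-reject; filter-none; filter-++; filter-≐; length-++; map-tabulate; map-++;
         ++-identityʳ; ++-assoc; unfold-reverse; reverse-++; reverse-map; reverse-involutive)
open import Data.List.Relation.Unary.All as All using (All; []; _∷_)
import Data.List.Relation.Unary.All.Properties as All
open import Data.List.Relation.Unary.AllPairs as AllPairs using (AllPairs; []; _∷_)
import Data.List.Relation.Unary.AllPairs.Properties as AllPairs
open import Data.List.Relation.Unary.Unique.Propositional using (Unique)
open import Data.Nat.Tactic.RingSolver using (solve-∀)
open import Data.Product using (_×_; _,_; proj₁; proj₂)
open import Data.Sum using (_⊎_; inj₁; inj₂; [_,_]′)
open import Function using (_∘_; id)
open import Function.Bundles using (Injection)
open import Function.Definitions using (Injective)
open import Function.Properties.Inverse using (↔⇒↣)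
open import Relation.Binary.Definitions using (tri<; tri≈; tri>)
open import Relation.Binary.PropositionalEquality hiding ([_])
open import Relation.Nullary using (Dec; yes; no; does; ¬_)
open import Relation.Nullary.Decidable using (dec-true; dec-false; _×-dec_)
open import Relation.Unary using (Pred; Decidable)
open import Relation.Unary.Properties using (∁?; _∩?_; _×?_)

module _ {a p q} {A : Set a} {P : Pred A p} {Q : Pred A q} (P? : Decidable P) (Q? : Decidable Q) where

  open ≡-Reasoning

  filter-filter : (xs : List A) → filter P? (filter Q? xs) ≡ filter (P? ∩? Q?) xs
  filter-filter [] = refl
  filter-filter (x ∷ xs) = go (P? x) (Q? x)
    where
    go : Dec (P x) → Dec (Q x) → filter P? (filter Q? (x ∷ xs)) ≡ filter (P? ∩? Q?) (x ∷ xs)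
    go (yes px) (yes qx) = begin
      filter P? (filter Q? (x ∷ xs)) ≡⟨ cong (filter P?) (filter-accept Q? qx) ⟩
      filter P? (x ∷ filter Q? xs)   ≡⟨ filter-accept P? px ⟩
      x ∷ filter P? (filter Q? xs)   ≡⟨ cong (x ∷_) (filter-filter xs) ⟩
      x ∷ filter (P? ∩? Q?) xs       ≡⟨ filter-accept (P? ∩? Q?) (px , qx) ⟨
      filter (P? ∩? Q?) (x ∷ xs)     ∎
    go (no ¬px) (yes qx) = begin
      filter P? (filter Q? (x ∷ xs)) ≡⟨ cong (filter P?) (filter-accept Q? qx) ⟩
      filter P? (x ∷ filter Q? xs)   ≡⟨ filter-reject P? ¬px ⟩
      filter P? (filter Q? xs)       ≡⟨ filter-filter xs ⟩
      filter (P? ∩? Q?) xs           ≡⟨ filter-reject (P? ∩? Q?) (¬px ∘ proj₁) ⟨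
      filter (P? ∩? Q?) (x ∷ xs)     ∎
    go _ (no ¬qx) = begin
      filter P? (filter Q? (x ∷ xs)) ≡⟨ cong (filter P?) (filter-reject Q? ¬qx) ⟩
      filter P? (filter Q? xs)       ≡⟨ filter-filter xs ⟩
      filter (P? ∩? Q?) xs           ≡⟨ filter-reject (P? ∩? Q?) (¬qx ∘ proj₂) ⟨
      filter (P? ∩? Q?) (x ∷ xs)     ∎

module _ {a b p q} {A : Set a} {B : Set b} {P : Pred A p} {Q : Pred B q}
         (P? : Decidable P) (Q? : Decidable Q) where

  open ≡-Reasoning

  filter-cartesianProduct : (xs : List A) (ys : List B) →
    filter (P? ×? Q?) (cartesianProduct xs ys) ≡ cartesianProduct (filter P? xs) (filter Q? ys)
  filter-cartesianProduct [] ys = refl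
  filter-cartesianProduct (x ∷ xs) ys = begin
    filter (P? ×? Q?) (map (x ,_) ys ++ cartesianProduct xs ys)
      ≡⟨ filter-++ (P? ×? Q?) (map (x ,_) ys) (cartesianProduct xs ys) ⟩
    filter (P? ×? Q?) (map (x ,_) ys) ++ filter (P? ×? Q?) (cartesianProduct xs ys)
      ≡⟨ cong (filter (P? ×? Q?) (map (x ,_) ys) ++_) (filter-cartesianProduct xs ys) ⟩
    filter (P? ×? Q?) (map (x ,_) ys) ++ cartesianProduct (filter P? xs) (filter Q? ys)
      ≡⟨ go (P? x) ⟩
    cartesianProduct (filter P? (x ∷ xs)) (filter Q? ys) ∎
    where
    row : P x → ∀ zs → filter (P? ×? Q?) (map (x ,_) zs) ≡ map (x ,_) (filter Q? zs)
    row px [] = refl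
    row px (z ∷ zs) = step (Q? z)
      where
      step : Dec (Q z) → filter (P? ×? Q?) (map (x ,_) (z ∷ zs)) ≡ map (x ,_) (filter Q? (z ∷ zs))
      step (yes qz) = trans (filter-accept (P? ×? Q?) (px , qz))
                            (trans (cong ((x , z) ∷_) (row px zs)) (cong (map (x ,_)) (sym (filter-accept Q? qz))))
      step (no ¬qz) = trans (filter-reject (P? ×? Q?) (¬qz ∘ proj₂))
                            (trans (row px zs) (cong (map (x ,_)) (sym (filter-reject Q? ¬qz))))
    go : Dec (P x) → filter (P? ×? Q?) (map (x ,_) ys) ++ cartesianProduct (filter P? xs) (filter Q? ys)
                   ≡ cartesianProduct (filter P? (x ∷ xs)) (filter Q? ys)
    go (yes px) = trans (cong (_++ _) (row px ys))
                        (cong (λ us → cartesianProduct us (filter Q? ys)) (sym (filter-accept P? px)))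
    go (no ¬px) = trans (cong (_++ _) (filter-none (P? ×? Q?) (All.map⁺ (All.universal (λ _ → ¬px ∘ proj₁) ys))))
                        (cong (λ us → cartesianProduct us (filter Q? ys)) (sym (filter-reject P? ¬px)))

module _ {a} {A : Set a} where

  cartesianProduct-[_]ˡ : ∀ {b} {B : Set b} (x : A) (ys : List B) → cartesianProduct [ x ] ys ≡ map (x ,_) ys
  cartesianProduct-[ x ]ˡ ys = ++-identityʳ (map (x ,_) ys)

  cartesianProduct-[_]ʳ : ∀ {b} {B : Set b} (y : A) (xs : List B) → cartesianProduct xs [ y ] ≡ map (_, y) xs
  cartesianProduct-[ y ]ʳ [] = refl
  cartesianProduct-[ y ]ʳ (x ∷ xs) = cong ((x , y) ∷_) (cartesianProduct-[ y ]ʳ xs)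

AllPairs-map-All : ∀ {a p r s} {A : Set a} {P : Pred A p} {R : A → A → Set r} {S : A → A → Set s} →
                   (∀ {x y} → P x → P y → R x y → S x y) → ∀ {xs} → All P xs → AllPairs R xs → AllPairs S xs
AllPairs-map-All R⇒S [] [] = []
AllPairs-map-All R⇒S (px ∷ pxs) (rx ∷ rxs) =
  All.zipWith (λ (py , rxy) → R⇒S px py rxy) (pxs , rx) ∷ AllPairs-map-All R⇒S pxs rxs

filter-≟-tabulate : ∀ {m n} (g : Fin m → Fin n) → Injective _≡_ _≡_ g →
                    (k : Fin m) → filter (_≟ g k) (tabulate g) ≡ [ g k ]
filter-≟-tabulate g g-inj F.zero =
  trans (filter-accept (_≟ g F.zero) refl)
        (cong (g F.zero ∷_) (filter-none (_≟ g F.zero) (All.tabulate⁺ {f = g ∘ F.suc} (λ i → 0≢1+n ∘ g-inj ∘ sym))))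
filter-≟-tabulate g g-inj (F.suc k) =
  trans (filter-reject (_≟ g (F.suc k)) (0≢1+n ∘ g-inj))
        (filter-≟-tabulate (g ∘ F.suc) (suc-injective ∘ g-inj) k)

filter-≟-allFin : ∀ {n} (k : Fin n) → filter (_≟ k) (allFin n) ≡ [ k ]
filter-≟-allFin = filter-≟-tabulate id id

All-reverse⁺ : ∀ {a p} {A : Set a} {P : Pred A p} {xs : List A} → All P xs → All P (reverse xs)
All-reverse⁺ {xs = []} [] = []
All-reverse⁺ {xs = x ∷ xs} (px ∷ pxs) rewrite unfold-reverse x xs = All.∷ʳ⁺ (All-reverse⁺ pxs) px

-- Transpositions

module _ {n : ℕ} where

  transp-≡ˡ : (a b : Fin n) → transp a b a ≡ b
  transp-≡ˡ a b = cong (λ t → if t then b else (if does (a ≟ b) then a else a)) (dec-true (a ≟ a) refl)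

  transp-≡ʳ : (a b : Fin n) → transp a b b ≡ a
  transp-≡ʳ a b with b ≟ a
  ... | yes refl = refl
  ... | no _     = cong (λ t → if t then a else b) (dec-true (b ≟ b) refl)

  transp-≢ : (a b : Fin n) {x : Fin n} → x ≢ a → x ≢ b → transp a b x ≡ x
  transp-≢ a b {x} x≢a x≢b =
    trans (cong (λ t → if t then b else (if does (x ≟ b) then a else x)) (dec-false (x ≟ a) x≢a))
          (cong (λ t → if t then a else x) (dec-false (x ≟ b) x≢b))

  transp-involutive : (a b x : Fin n) → transp a b (transp a b x) ≡ x
  transp-involutive a b x = go (x ≟ a) (x ≟ b)
    where
    go : Dec (x ≡ a) → Dec (x ≡ b) → transp a b (transp a b x) ≡ x
    go (yes refl) _        rewrite transp-≡ˡ x b = transp-≡ʳ x b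
    go (no _)     (yes refl) rewrite transp-≡ʳ a x = transp-≡ˡ a x
    go (no x≢a)   (no x≢b) rewrite transp-≢ a b x≢a x≢b = transp-≢ a b x≢a x≢b

  transp-sym : (a b x : Fin n) → transp a b x ≡ transp b a x
  transp-sym a b x = go (x ≟ a) (x ≟ b)
    where
    go : Dec (x ≡ a) → Dec (x ≡ b) → transp a b x ≡ transp b a x
    go (yes refl) _          = trans (transp-≡ˡ x b) (sym (transp-≡ʳ b x))
    go (no _)     (yes refl) = trans (transp-≡ʳ a x) (sym (transp-≡ˡ x a))
    go (no x≢a)   (no x≢b)   = trans (transp-≢ a b x≢a x≢b) (sym (transp-≢ b a x≢b x≢a))

  transp-comm : (a b c d : Fin n) → a ≢ c → a ≢ d → b ≢ c → b ≢ d →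
                (x : Fin n) → transp a b (transp c d x) ≡ transp c d (transp a b x)
  transp-comm a b c d a≢c a≢d b≢c b≢d x = go (x ≟ a) (x ≟ b) (x ≟ c) (x ≟ d)
    where
    go : Dec (x ≡ a) → Dec (x ≡ b) → Dec (x ≡ c) → Dec (x ≡ d) →
         transp a b (transp c d x) ≡ transp c d (transp a b x)
    go (yes refl) _ _ _
      rewrite transp-≢ c d a≢c a≢d | transp-≡ˡ x b | transp-≢ c d b≢c b≢d = refl
    go (no _) (yes refl) _ _
      rewrite transp-≢ c d b≢c b≢d | transp-≡ʳ a x | transp-≢ c d a≢c a≢d = refl
    go (no x≢a) (no x≢b) (yes refl) _
      rewrite transp-≡ˡ x d | transp-≢ a b x≢a x≢b | transp-≡ˡ x d
            | transp-≢ a b (a≢d ∘ sym) (b≢d ∘ sym) = refl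
    go (no x≢a) (no x≢b) (no _) (yes refl)
      rewrite transp-≡ʳ c x | transp-≢ a b x≢a x≢b | transp-≡ʳ c x
            | transp-≢ a b (a≢c ∘ sym) (b≢c ∘ sym) = refl
    go (no x≢a) (no x≢b) (no x≢c) (no x≢d)
      rewrite transp-≢ c d x≢c x≢d | transp-≢ a b x≢a x≢b = sym (transp-≢ c d x≢c x≢d)

  transps : List (Fin n × Fin n) → Fin n → Fin n
  transps [] x = x
  transps ((a , b) ∷ ts) x = transp a b (transps ts x)

  foldl-transps : (g : Fin n → Fin n) (ts : List (Fin n × Fin n)) (x : Fin n) →
                  foldl (λ f t → f ∘ transp (proj₁ t) (proj₂ t)) g ts x ≡ g (transps ts x)
  foldl-transps g [] x = refl
  foldl-transps g ((a , b) ∷ ts) x = foldl-transps (g ∘ transp a b) ts x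

  eta-transps : (σ : Fin n → Fin n) (k : ℕ) (x : Fin n) → eta σ k x ≡ σ (transps (W σ k) x)
  eta-transps σ k = foldl-transps σ (W σ k)

  transps-++ : (ss ts : List (Fin n × Fin n)) (x : Fin n) → transps (ss ++ ts) x ≡ transps ss (transps ts x)
  transps-++ [] ts x = refl
  transps-++ ((a , b) ∷ ss) ts x = cong (transp a b) (transps-++ ss ts x)

  Commute : Fin n × Fin n → Fin n × Fin n → Set
  Commute (a , b) (c , d) = ∀ x → transp a b (transp c d x) ≡ transp c d (transp a b x)

  transp-transps-comm : ∀ {a b} ts → All (Commute (a , b)) ts →
                        ∀ x → transp a b (transps ts x) ≡ transps ts (transp a b x)
  transp-transps-comm [] [] x = refl
  transp-transps-comm ((c , d) ∷ ts) (comm ∷ comms) x =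
    trans (comm (transps ts x)) (cong (transp c d) (transp-transps-comm ts comms x))

  transps-split : ∀ {p} {P : Pred (Fin n × Fin n) p} (P? : Decidable P) ts →
                  AllPairs (λ s t → P s → ¬ P t → Commute s t) ts →
                  ∀ x → transps ts x ≡ transps (filter (∁? P?) ts) (transps (filter P? ts) x)
  transps-split P? [] [] x = refl
  transps-split {P = P} P? ((a , b) ∷ ts) (comms ∷ commss) x = go (P? (a , b))
    where
    IH : transps ts x ≡ transps (filter (∁? P?) ts) (transps (filter P? ts) x)
    IH = transps-split P? ts commss x
    go : Dec (P (a , b)) → transps ((a , b) ∷ ts) x
                         ≡ transps (filter (∁? P?) ((a , b) ∷ ts)) (transps (filter P? ((a , b) ∷ ts)) x)
    go (yes p) = begin
      transp a b (transps ts x)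
        ≡⟨ cong (transp a b) IH ⟩
      transp a b (transps (filter (∁? P?) ts) (transps (filter P? ts) x))
        ≡⟨ transp-transps-comm (filter (∁? P?) ts) comms′ _ ⟩
      transps (filter (∁? P?) ts) (transp a b (transps (filter P? ts) x))
        ≡⟨ cong₂ (λ us vs → transps us (transps vs x)) (filter-reject (∁? P?) (λ ¬p → ¬p p)) (filter-accept P? p) ⟨
      transps (filter (∁? P?) ((a , b) ∷ ts)) (transps (filter P? ((a , b) ∷ ts)) x) ∎
      where
      open ≡-Reasoning
      comms′ : All (Commute (a , b)) (filter (∁? P?) ts)
      comms′ = All.zipWith (λ (¬pt , c) → c p ¬pt) (All.all-filter (∁? P?) ts , All.filter⁺ (∁? P?) comms)
    go (no ¬p) = trans (cong (transp a b) IH)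
      (sym (cong₂ (λ us vs → transps us (transps vs x)) (filter-accept (∁? P?) ¬p) (filter-reject P? ¬p)))

-- Insertion sort along ≺

module Sorting {n : ℕ} (σ : Fin n → Fin n) (σ-injective : Injective _≡_ _≡_ σ) where

  Pair : Set
  Pair = Fin n × Fin n

  _≺_ : Pair → Pair → Set
  _≺_ = Prec σ

  ≺-asym : ∀ {s t} → s ≺ t → ¬ t ≺ s
  ≺-asym (inj₁ p) (inj₁ q) = <-asym p q
  ≺-asym (inj₁ p) (inj₂ (refl , _)) = <-irrefl refl p
  ≺-asym (inj₂ (refl , _)) (inj₁ q) = <-irrefl refl q
  ≺-asym (inj₂ (refl , p)) (inj₂ (_ , q)) = <-asym p q

  ≺-trans : ∀ {s t u} → s ≺ t → t ≺ u → s ≺ u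
  ≺-trans (inj₁ p) (inj₁ q) = inj₁ (<-trans q p)
  ≺-trans (inj₁ p) (inj₂ (refl , _)) = inj₁ p
  ≺-trans (inj₂ (refl , _)) (inj₁ q) = inj₁ q
  ≺-trans (inj₂ (refl , p)) (inj₂ (refl , q)) = inj₂ (refl , <-trans p q)

  ≺-cotrans : ∀ {s u} t → s ≺ u → s ≺ t ⊎ t ≺ u
  ≺-cotrans {a , b} {e , g} (c , d) s≺u with <-cmp (σ c) (σ a)
  ... | tri< σc<σa _ _ = inj₁ (inj₁ σc<σa)
  ... | tri> _ _ σa<σc = inj₂ (go s≺u)
    where
    go : (a , b) ≺ (e , g) → (c , d) ≺ (e , g)
    go (inj₁ σe<σa) = inj₁ (<-trans σe<σa σa<σc)
    go (inj₂ (refl , _)) = inj₁ σa<σc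
  ... | tri≈ _ σc≡σa _ with σ-injective σc≡σa | <-cmp (σ d) (σ b)
  ...   | refl | tri> _ _ σb<σd = inj₁ (inj₂ (refl , σb<σd))
  ...   | refl | tri≈ _ σd≡σb _ rewrite σ-injective σd≡σb = inj₂ s≺u
  ...   | refl | tri< σd<σb _ _ = inj₂ (go s≺u)
    where
    go : (c , b) ≺ (e , g) → (c , d) ≺ (e , g)
    go (inj₁ σe<σc) = inj₁ σe<σc
    go (inj₂ (refl , σb<σg)) = inj₂ (refl , <-trans σd<σb σb<σg)

  insert : Pair → List Pair → List Pair
  insert = insert≺ σ

  sort : List Pair → List Pair
  sort = sort≺ σ

  Sorted : List Pair → Set
  Sorted = AllPairs (λ s t → ¬ t ≺ s)

  insert-≺ : ∀ {s t} ts → s ≺ t → insert s (t ∷ ts) ≡ s ∷ t ∷ ts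
  insert-≺ {s} {t} ts s≺t = cong (λ c → if c then s ∷ t ∷ ts else t ∷ insert s ts) (dec-true (prec? σ s t) s≺t)

  insert-⊀ : ∀ {s t} ts → ¬ s ≺ t → insert s (t ∷ ts) ≡ t ∷ insert s ts
  insert-⊀ {s} {t} ts s⊀t = cong (λ c → if c then s ∷ t ∷ ts else t ∷ insert s ts) (dec-false (prec? σ s t) s⊀t)

  All-insert : ∀ {p} {P : Pred Pair p} {s} ts → P s → All P ts → All P (insert s ts)
  All-insert [] ps [] = ps ∷ []
  All-insert {P = P} {s} (t ∷ ts) ps (pt ∷ pts) with prec? σ s t
  ... | yes s≺t = subst (All P) (sym (insert-≺ ts s≺t)) (ps ∷ pt ∷ pts)
  ... | no s⊀t  = subst (All P) (sym (insert-⊀ ts s⊀t)) (pt ∷ All-insert ts ps pts)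

  All-sort : ∀ {p} {P : Pred Pair p} ts → All P ts → All P (sort ts)
  All-sort [] [] = []
  All-sort (t ∷ ts) (pt ∷ pts) = All-insert (sort ts) pt (All-sort ts pts)

  insert-sorted : ∀ s ts → Sorted ts → Sorted (insert s ts)
  insert-sorted s [] [] = [] ∷ []
  insert-sorted s (t ∷ ts) (t-first ∷ ts-sorted) with prec? σ s t
  ... | yes s≺t = subst Sorted (sym (insert-≺ ts s≺t))
                    ((≺-asym s≺t ∷ All.map (λ u⊀t u≺s → u⊀t (≺-trans u≺s s≺t)) t-first) ∷ t-first ∷ ts-sorted)
  ... | no s⊀t  = subst Sorted (sym (insert-⊀ ts s⊀t)) (All-insert ts s⊀t t-first ∷ insert-sorted s ts ts-sorted)

  sort-sorted : ∀ ts → Sorted (sort ts)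
  sort-sorted [] = []
  sort-sorted (t ∷ ts) = insert-sorted t (sort ts) (sort-sorted ts)

  insert-minimum : ∀ s ts → All (s ≺_) ts → insert s ts ≡ s ∷ ts
  insert-minimum s [] [] = refl
  insert-minimum s (t ∷ ts) (s≺t ∷ _) = insert-≺ ts s≺t

  insert-maximum : ∀ s ts → All (_≺ s) ts → insert s ts ≡ ts ++ [ s ]
  insert-maximum s [] [] = refl
  insert-maximum s (t ∷ ts) (t≺s ∷ ts≺s) = trans (insert-⊀ ts (≺-asym t≺s)) (cong (t ∷_) (insert-maximum s ts ts≺s))

  sort-ascending : ∀ ts → AllPairs _≺_ ts → sort ts ≡ ts
  sort-ascending [] [] = refl
  sort-ascending (t ∷ ts) (t≺ts ∷ ts-asc) = trans (cong (insert t) (sort-ascending ts ts-asc)) (insert-minimum t ts t≺ts)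

  sort-descending : ∀ ts → AllPairs (λ s t → t ≺ s) ts → sort ts ≡ reverse ts
  sort-descending [] [] = refl
  sort-descending (t ∷ ts) (ts≺t ∷ ts-desc) = begin
    insert t (sort ts)      ≡⟨ cong (insert t) (sort-descending ts ts-desc) ⟩
    insert t (reverse ts)   ≡⟨ insert-maximum t (reverse ts) (All-reverse⁺ ts≺t) ⟩
    reverse ts ++ [ t ]     ≡⟨ unfold-reverse t ts ⟨
    reverse (t ∷ ts)        ∎
    where open ≡-Reasoning

  module _ {p} {P : Pred Pair p} (P? : Decidable P) where

    filter-insert-reject : ∀ {s} ts → ¬ P s → filter P? (insert s ts) ≡ filter P? ts
    filter-insert-reject [] ¬ps = filter-reject P? ¬ps
    filter-insert-reject {s} (t ∷ ts) ¬ps = go (prec? σ s t)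
      where
      go : Dec (s ≺ t) → filter P? (insert s (t ∷ ts)) ≡ filter P? (t ∷ ts)
      go (yes s≺t) = trans (cong (filter P?) (insert-≺ ts s≺t)) (filter-reject P? ¬ps)
      go (no s⊀t) = trans (cong (filter P?) (insert-⊀ ts s⊀t)) (step (P? t))
        where
        step : Dec (P t) → filter P? (t ∷ insert s ts) ≡ filter P? (t ∷ ts)
        step (yes pt) = trans (filter-accept P? pt)
                          (trans (cong (t ∷_) (filter-insert-reject ts ¬ps)) (sym (filter-accept P? pt)))
        step (no ¬pt) = trans (filter-reject P? ¬pt)
                          (trans (filter-insert-reject ts ¬ps) (sym (filter-reject P? ¬pt)))

    filter-insert-accept : ∀ {s} ts → P s → Sorted ts → filter P? (insert s ts) ≡ insert s (filter P? ts)
    filter-insert-accept [] ps [] = filter-accept P? ps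
    filter-insert-accept {s} (t ∷ ts) ps (t-first ∷ ts-sorted) = go (prec? σ s t)
      where
      open ≡-Reasoning
      go : Dec (s ≺ t) → filter P? (insert s (t ∷ ts)) ≡ insert s (filter P? (t ∷ ts))
      go (yes s≺t) = begin
        filter P? (insert s (t ∷ ts))  ≡⟨ cong (filter P?) (insert-≺ ts s≺t) ⟩
        filter P? (s ∷ t ∷ ts)         ≡⟨ filter-accept P? ps ⟩
        s ∷ filter P? (t ∷ ts)         ≡⟨ insert-minimum s (filter P? (t ∷ ts)) (All.filter⁺ P? s≺t∷ts) ⟨
        insert s (filter P? (t ∷ ts))  ∎
        where
        s≺t∷ts : All (s ≺_) (t ∷ ts)
        s≺t∷ts = s≺t ∷ All.map (λ {u} u⊀t → [ (λ s≺u → s≺u) , (λ u≺t → ⊥-elim (u⊀t u≺t)) ]′ (≺-cotrans u s≺t)) t-first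
      go (no s⊀t) = trans (cong (filter P?) (insert-⊀ ts s⊀t)) (step (P? t))
        where
        IH = filter-insert-accept ts ps ts-sorted
        step : Dec (P t) → filter P? (t ∷ insert s ts) ≡ insert s (filter P? (t ∷ ts))
        step (yes pt) = begin
          filter P? (t ∷ insert s ts)    ≡⟨ filter-accept P? pt ⟩
          t ∷ filter P? (insert s ts)    ≡⟨ cong (t ∷_) IH ⟩
          t ∷ insert s (filter P? ts)    ≡⟨ insert-⊀ (filter P? ts) s⊀t ⟨
          insert s (t ∷ filter P? ts)    ≡⟨ cong (insert s) (filter-accept P? pt) ⟨
          insert s (filter P? (t ∷ ts))  ∎
        step (no ¬pt) = trans (filter-reject P? ¬pt) (trans IH (cong (insert s) (sym (filter-reject P? ¬pt))))

    filter-sort : ∀ ts → filter P? (sort ts) ≡ sort (filter P? ts)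
    filter-sort [] = refl
    filter-sort (t ∷ ts) = go (P? t)
      where
      go : Dec (P t) → filter P? (sort (t ∷ ts)) ≡ sort (filter P? (t ∷ ts))
      go (yes pt) = trans (filter-insert-accept (sort ts) pt (sort-sorted ts))
                      (trans (cong (insert t) (filter-sort ts)) (cong sort (sym (filter-accept P? pt))))
      go (no ¬pt) = trans (filter-insert-reject (sort ts) ¬pt)
                      (trans (filter-sort ts) (cong sort (sym (filter-reject P? ¬pt))))

-- Counting inversions

𝟙 : ∀ {p} {P : Set p} → Dec P → ℕ
𝟙 d = if does d then 1 else 0

module _ {p} {P : Set p} where

  𝟙-yes : (P? : Dec P) → P → 𝟙 P? ≡ 1
  𝟙-yes P? p = cong (λ c → if c then 1 else 0) (dec-true P? p)

  𝟙-no : (P? : Dec P) → ¬ P → 𝟙 P? ≡ 0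
  𝟙-no P? ¬p = cong (λ c → if c then 1 else 0) (dec-false P? ¬p)

module _ {p q} {P : Set p} {Q : Set q} where

  𝟙-mono : (P? : Dec P) (Q? : Dec Q) → (P → Q) → 𝟙 P? ≤ 𝟙 Q?
  𝟙-mono (yes p) Q? P→Q = ℕ.≤-reflexive (sym (𝟙-yes Q? (P→Q p)))
  𝟙-mono (no _)  Q? P→Q = z≤n

  𝟙-×-yes : (P? : Dec P) (Q? : Dec Q) → P → 𝟙 (P? ×-dec Q?) ≡ 𝟙 Q?
  𝟙-×-yes P? Q? p = cong (λ c → if c ∧ does Q? then 1 else 0) (dec-true P? p)

  𝟙-×-no : (P? : Dec P) (Q? : Dec Q) → ¬ P → 𝟙 (P? ×-dec Q?) ≡ 0
  𝟙-×-no P? Q? ¬p = cong (λ c → if c ∧ does Q? then 1 else 0) (dec-false P? ¬p)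

module _ {a p} {A : Set a} {P : Pred A p} (P? : Decidable P) where

  length-filter-tabulate : ∀ {m} (g : Fin m → A) → length (filter P? (tabulate g)) ≡ sum (λ i → 𝟙 (P? (g i)))
  length-filter-tabulate {zero} g = refl
  length-filter-tabulate {suc m} g with P? (g F.zero)
  ... | yes _ = cong suc (length-filter-tabulate (g ∘ F.suc))
  ... | no _  = length-filter-tabulate (g ∘ F.suc)

module _ {a b p} {A : Set a} {B : Set b} {P : Pred (A × B) p} (P? : Decidable P) where

  length-filter-cartesianProduct : ∀ {l m} (g : Fin l → A) (h : Fin m → B) →
    length (filter P? (cartesianProduct (tabulate g) (tabulate h))) ≡ sum (λ i → sum (λ j → 𝟙 (P? (g i , h j))))
  length-filter-cartesianProduct {zero} g h = refl
  length-filter-cartesianProduct {suc l} g h = begin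
    length (filter P? (row ++ rest))                 ≡⟨ cong length (filter-++ P? row rest) ⟩
    length (filter P? row ++ filter P? rest)         ≡⟨ length-++ (filter P? row) ⟩
    length (filter P? row) + length (filter P? rest)
      ≡⟨ cong₂ _+_ (trans (cong (length ∘ filter P?) (map-tabulate h (g F.zero ,_)))
                          (length-filter-tabulate P? ((g F.zero ,_) ∘ h)))
                   (length-filter-cartesianProduct (g ∘ F.suc) h) ⟩
    sum (λ i → sum (λ j → 𝟙 (P? (g i , h j))))       ∎
    where
    open ≡-Reasoning
    row rest : List (A × B)
    row = map (g F.zero ,_) (tabulate h)
    rest = cartesianProduct (tabulate (g ∘ F.suc)) (tabulate h)

module _ {n : ℕ} where

  zeroAt : Fin n → (Fin n → ℕ) → Fin n → ℕ
  zeroAt a g c = if does (c ≟ a) then 0 else g c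

  zeroAt-≢ : ∀ {a c} (g : Fin n → ℕ) → c ≢ a → zeroAt a g c ≡ g c
  zeroAt-≢ {a} {c} g c≢a = cong (λ t → if t then 0 else g c) (dec-false (c ≟ a) c≢a)

  zeroAt-mono : ∀ {a} {g h : Fin n → ℕ} → (∀ c → c ≢ a → g c ≤ h c) → ∀ c → zeroAt a g c ≤ zeroAt a h c
  zeroAt-mono {a} g≤h c with c ≟ a
  ... | yes _   = z≤n
  ... | no c≢a  = g≤h c c≢a

sum-zeroAt : ∀ {n} (a : Fin n) (g : Fin n → ℕ) → sum g ≡ g a + sum (zeroAt a g)
sum-zeroAt F.zero g = refl
sum-zeroAt {suc n} (F.suc a) g = begin
  g F.zero + sum (g ∘ F.suc)                              ≡⟨ cong (g F.zero +_) (sum-zeroAt a (g ∘ F.suc)) ⟩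
  g F.zero + (g (F.suc a) + sum (zeroAt a (g ∘ F.suc)))   ≡⟨ x∙yz≈y∙xz (g F.zero) (g (F.suc a)) _ ⟩
  g (F.suc a) + (g F.zero + sum (zeroAt a (g ∘ F.suc)))   ≡⟨ cong (λ s → g (F.suc a) + (g F.zero + s)) (sum-cong-≗ zeroAt-suc) ⟩
  g (F.suc a) + sum (zeroAt (F.suc a) g)                  ∎
  where
  open ≡-Reasoning
  zeroAt-suc : ∀ i → zeroAt a (g ∘ F.suc) i ≡ zeroAt (F.suc a) g (F.suc i)
  zeroAt-suc i with i ≟ a
  ... | yes refl = refl
  ... | no _     = refl

sum-mono : ∀ {n} {g h : Fin n → ℕ} → (∀ i → g i ≤ h i) → sum g ≤ sum h
sum-mono {zero}  g≤h = z≤n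
sum-mono {suc n} g≤h = ℕ.+-mono-≤ (g≤h F.zero) (sum-mono (g≤h ∘ F.suc))

sum-mono-at : ∀ {n} {g h : Fin n → ℕ} (c : Fin n) {d} → (∀ i → g i ≤ h i) → g c + d ≤ h c → sum g + d ≤ sum h
sum-mono-at {g = g} {h} c {d} g≤h gc+d≤hc = begin
  sum g + d                     ≡⟨ cong (_+ d) (sum-zeroAt c g) ⟩
  g c + sum (zeroAt c g) + d    ≡⟨ xy∙z≈xz∙y (g c) (sum (zeroAt c g)) d ⟩
  g c + d + sum (zeroAt c g)    ≤⟨ ℕ.+-mono-≤ gc+d≤hc (sum-mono (zeroAt-mono (λ i _ → g≤h i))) ⟩
  h c + sum (zeroAt c h)        ≡⟨ sum-zeroAt c h ⟨
  sum h                         ∎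
  where open ℕ.≤-Reasoning

module _ {n : ℕ} {a b : Fin n} (b≢a : b ≢ a) where

  zeroAt₂ : (Fin n → ℕ) → Fin n → ℕ
  zeroAt₂ g = zeroAt b (zeroAt a g)

  zeroAt₂-≢ : ∀ {c} (g : Fin n → ℕ) → c ≢ a → c ≢ b → zeroAt₂ g c ≡ g c
  zeroAt₂-≢ g c≢a c≢b = trans (zeroAt-≢ (zeroAt a g) c≢b) (zeroAt-≢ g c≢a)

  zeroAt₂-mono : ∀ {g h : Fin n → ℕ} → (∀ c → c ≢ a → c ≢ b → g c ≤ h c) → ∀ c → zeroAt₂ g c ≤ zeroAt₂ h c
  zeroAt₂-mono g≤h c with c ≟ b | c ≟ a
  ... | yes _   | _       = z≤n
  ... | no _    | yes _   = z≤n
  ... | no c≢b  | no c≢a  = g≤h c c≢a c≢b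

  sum-zeroAt₂-cong : ∀ {g h : Fin n → ℕ} → (∀ c → c ≢ a → c ≢ b → g c ≡ h c) → sum (zeroAt₂ g) ≡ sum (zeroAt₂ h)
  sum-zeroAt₂-cong {g} {h} g≡h = sum-cong-≗ pointwise
    where
    pointwise : ∀ c → zeroAt₂ g c ≡ zeroAt₂ h c
    pointwise c with c ≟ b | c ≟ a
    ... | yes _   | _       = refl
    ... | no _    | yes _   = refl
    ... | no c≢b  | no c≢a  = g≡h c c≢a c≢b

  sum-zeroAt₂-+ : ∀ (g h : Fin n → ℕ) → sum (zeroAt₂ (λ c → g c + h c)) ≡ sum (zeroAt₂ g) + sum (zeroAt₂ h)
  sum-zeroAt₂-+ g h = trans (sum-cong-≗ pointwise) (∑-distrib-+ (zeroAt₂ g) (zeroAt₂ h))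
    where
    pointwise : ∀ c → zeroAt₂ (λ i → g i + h i) c ≡ zeroAt₂ g c + zeroAt₂ h c
    pointwise c with c ≟ b | c ≟ a
    ... | yes _   | _       = refl
    ... | no _    | yes _   = refl
    ... | no _    | no _    = refl

  sum-zeroAt₂ : (g : Fin n → ℕ) → sum g ≡ g a + (g b + sum (zeroAt₂ g))
  sum-zeroAt₂ g = trans (sum-zeroAt a g)
    (cong (g a +_) (trans (sum-zeroAt b (zeroAt a g)) (cong (_+ sum (zeroAt₂ g)) (zeroAt-≢ g b≢a))))

  sum-sum-split : (M : Fin n → Fin n → ℕ) →
    sum (λ i → sum (M i))
      ≡ (M a a + M a b + M b a + M b b)
        + (sum (zeroAt₂ (λ c → (M a c + M b c) + (M c a + M c b))) + sum (zeroAt₂ (λ i → sum (zeroAt₂ (M i)))))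
  sum-sum-split M = begin
    sum R
      ≡⟨ sum-zeroAt₂ R ⟩
    R a + (R b + sum (zeroAt₂ R))
      ≡⟨ cong₂ (λ u v → u + (v + sum (zeroAt₂ R))) (sum-zeroAt₂ (M a)) (sum-zeroAt₂ (M b)) ⟩
    (M a a + (M a b + Sa)) + ((M b a + (M b b + Sb)) + sum (zeroAt₂ R))
      ≡⟨ cong (λ s → (M a a + (M a b + Sa)) + ((M b a + (M b b + Sb)) + s)) rest ⟩
    (M a a + (M a b + Sa)) + ((M b a + (M b b + Sb)) + (Scol + Sinner))
      ≡⟨ arith (M a a) (M a b) (M b a) (M b b) Sa Sb Scol Sinner ⟩
    (M a a + M a b + M b a + M b b) + ((Sa + Sb + Scol) + Sinner)
      ≡⟨ cong (λ s → (M a a + M a b + M b a + M b b) + (s + Sinner)) cross ⟨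
    (M a a + M a b + M b a + M b b) + (sum (zeroAt₂ (λ c → (M a c + M b c) + (M c a + M c b))) + Sinner) ∎
    where
    open ≡-Reasoning
    R : Fin n → ℕ
    R i = sum (M i)
    Sa Sb Scol Sinner : ℕ
    Sa = sum (zeroAt₂ (M a))
    Sb = sum (zeroAt₂ (M b))
    Scol = sum (zeroAt₂ (λ i → M i a + M i b))
    Sinner = sum (zeroAt₂ (λ i → sum (zeroAt₂ (M i))))
    rest : sum (zeroAt₂ R) ≡ Scol + Sinner
    rest = trans (sum-zeroAt₂-cong (λ i _ _ → trans (sum-zeroAt₂ (M i)) (sym (ℕ.+-assoc (M i a) (M i b) _))))
                 (sum-zeroAt₂-+ (λ i → M i a + M i b) (λ i → sum (zeroAt₂ (M i))))
    cross : sum (zeroAt₂ (λ c → (M a c + M b c) + (M c a + M c b))) ≡ Sa + Sb + Scol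
    cross = trans (sum-zeroAt₂-+ (λ c → M a c + M b c) (λ c → M c a + M c b)) (cong (_+ Scol) (sum-zeroAt₂-+ (M a) (M b)))
    arith : ∀ x₁ x₂ x₃ x₄ s₁ s₂ s₃ s₄ →
            (x₁ + (x₂ + s₁)) + ((x₃ + (x₄ + s₂)) + (s₃ + s₄)) ≡ (x₁ + x₂ + x₃ + x₄) + ((s₁ + s₂ + s₃) + s₄)
    arith = solve-∀

module _ {n : ℕ} where

  inverted : Fin n → Fin n → Fin n → Fin n → ℕ
  inverted i j u v = 𝟙 ((i F.<? j) ×-dec (v F.<? u))

  inversion : (Fin n → Fin n) → Fin n → Fin n → ℕ
  inversion f i j = inverted i j (f i) (f j)

  inv-sum : (f : Fin n → Fin n) → inv f ≡ sum (λ i → sum (inversion f i))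
  inv-sum f = length-filter-cartesianProduct (λ p → (proj₁ p F.<? proj₂ p) ×-dec (f (proj₂ p) F.<? f (proj₁ p))) id id

  inv-cong : {f g : Fin n → Fin n} → (∀ x → f x ≡ g x) → inv f ≡ inv g
  inv-cong {f} {g} f≗g = begin
    inv f                                ≡⟨ inv-sum f ⟩
    sum (λ i → sum (inversion f i))      ≡⟨ sum-cong-≗ (λ i → sum-cong-≗ (λ j →
                                              cong₂ (inverted i j) (f≗g i) (f≗g j))) ⟩
    sum (λ i → sum (inversion g i))      ≡⟨ inv-sum g ⟨
    inv g                                ∎
    where open ≡-Reasoning

  inverted-≮ : ∀ {i j} u v → ¬ i < j → inverted i j u v ≡ 0
  inverted-≮ {i} {j} u v i≮j = 𝟙-×-no (i F.<? j) (v F.<? u) i≮j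

  inverted-< : ∀ {i j} u v → i < j → inverted i j u v ≡ 𝟙 (v F.<? u)
  inverted-< {i} {j} u v i<j = 𝟙-×-yes (i F.<? j) (v F.<? u) i<j

-- Swapping the values at a < b with f a < f b makes (a , b) an inversion, leaves the pairs avoiding
-- a and b unchanged, does not decrease the number of inversions between any other c and {a , b},
-- and adds two of them when a < c < b and f a < f c < f b.
module _ {n : ℕ} (f : Fin n → Fin n) {a b : Fin n} (a<b : a < b) (fa<fb : f a < f b) where

  private
    b≢a : b ≢ a
    b≢a = <⇒≢ a<b ∘ sym

    f′ : Fin n → Fin n
    f′ = f ∘ transp a b

    f′a : f′ a ≡ f b
    f′a = cong f (transp-≡ˡ a b)

    f′b : f′ b ≡ f a
    f′b = cong f (transp-≡ʳ a b)

    f′c : ∀ {c} → c ≢ a → c ≢ b → f′ c ≡ f c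
    f′c c≢a c≢b = cong f (transp-≢ a b c≢a c≢b)

    corner : (Fin n → Fin n) → ℕ
    corner g = inversion g a a + inversion g a b + inversion g b a + inversion g b b

    cross : (Fin n → Fin n) → Fin n → ℕ
    cross g c = (inversion g a c + inversion g b c) + (inversion g c a + inversion g c b)

    inner : (Fin n → Fin n) → ℕ
    inner g = sum (zeroAt₂ b≢a (λ i → sum (zeroAt₂ b≢a (inversion g i))))

    crossSum : (Fin n → Fin n) → ℕ
    crossSum g = sum (zeroAt₂ b≢a (cross g))

    inv-split : ∀ g → inv g ≡ corner g + (crossSum g + inner g)
    inv-split g = trans (inv-sum g) (sum-sum-split b≢a (inversion g))

    corner-f : corner f ≡ 0
    corner-f = cong₂ _+_ (cong₂ _+_ (cong₂ _+_ (inverted-≮ {i = a} {j = a} (f a) (f a) (<-irrefl refl))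
                                             (trans (inverted-< (f a) (f b) a<b) (𝟙-no (f b F.<? f a) (<-asym fa<fb))))
                                  (inverted-≮ {i = b} {j = a} (f b) (f a) (<-asym a<b)))
                       (inverted-≮ {i = b} {j = b} (f b) (f b) (<-irrefl refl))

    corner-f′ : corner f′ ≡ 1
    corner-f′ = cong₂ _+_ (cong₂ _+_ (cong₂ _+_ (inverted-≮ {i = a} {j = a} (f′ a) (f′ a) (<-irrefl refl))
                                              (trans (inverted-< (f′ a) (f′ b) a<b)
                                                     (𝟙-yes (f′ b F.<? f′ a) (subst₂ _<_ (sym f′b) (sym f′a) fa<fb))))
                                   (inverted-≮ {i = b} {j = a} (f′ b) (f′ a) (<-asym a<b)))
                        (inverted-≮ {i = b} {j = b} (f′ b) (f′ b) (<-irrefl refl))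

    inner-f′ : inner f′ ≡ inner f
    inner-f′ = sum-zeroAt₂-cong b≢a (λ i i≢a i≢b → sum-zeroAt₂-cong b≢a (λ j j≢a j≢b →
                 cong₂ (inverted i j) (f′c i≢a i≢b) (f′c j≢a j≢b)))

    crossᵛ : Fin n → Fin n → Fin n → Fin n → ℕ
    crossᵛ c u₁ u₂ w = (inverted a c u₁ w + inverted b c u₂ w) + (inverted c a w u₁ + inverted c b w u₂)

    cross-f′ : ∀ {c} → c ≢ a → c ≢ b → cross f′ c ≡ crossᵛ c (f b) (f a) (f c)
    cross-f′ {c} c≢a c≢b =
      cong₂ _+_ (cong₂ _+_ (cong₂ (inverted a c) f′a (f′c c≢a c≢b)) (cong₂ (inverted b c) f′b (f′c c≢a c≢b)))
                (cong₂ _+_ (cong₂ (inverted c a) (f′c c≢a c≢b) f′a) (cong₂ (inverted c b) (f′c c≢a c≢b) f′b))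

    crossᵛ-below : ∀ {c} u₁ u₂ w → c < a → crossᵛ c u₁ u₂ w ≡ 𝟙 (u₁ F.<? w) + 𝟙 (u₂ F.<? w)
    crossᵛ-below {c} u₁ u₂ w c<a =
      cong₂ _+_ (cong₂ _+_ (inverted-≮ u₁ w (<-asym c<a)) (inverted-≮ u₂ w (<-asym (<-trans c<a a<b))))
                (cong₂ _+_ (inverted-< w u₁ c<a) (inverted-< w u₂ (<-trans c<a a<b)))

    crossᵛ-between : ∀ {c} u₁ u₂ w → a < c → c < b → crossᵛ c u₁ u₂ w ≡ 𝟙 (w F.<? u₁) + 𝟙 (u₂ F.<? w)
    crossᵛ-between {c} u₁ u₂ w a<c c<b =
      cong₂ _+_ (trans (cong₂ _+_ (inverted-< u₁ w a<c) (inverted-≮ u₂ w (<-asym c<b))) (ℕ.+-identityʳ _))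
                (cong₂ _+_ (inverted-≮ w u₁ (<-asym a<c)) (inverted-< w u₂ c<b))

    crossᵛ-above : ∀ {c} u₁ u₂ w → b < c → crossᵛ c u₁ u₂ w ≡ 𝟙 (w F.<? u₁) + 𝟙 (w F.<? u₂)
    crossᵛ-above {c} u₁ u₂ w b<c =
      trans (cong₂ _+_ (cong₂ _+_ (inverted-< u₁ w (<-trans a<b b<c)) (inverted-< u₂ w b<c))
                       (cong₂ _+_ (inverted-≮ w u₁ (<-asym (<-trans a<b b<c))) (inverted-≮ w u₂ (<-asym b<c))))
            (ℕ.+-identityʳ _)

    cross-mono : ∀ c → c ≢ a → c ≢ b → cross f c ≤ cross f′ c
    cross-mono c c≢a c≢b with <-cmp c a
    ... | tri≈ _ c≡a _ = ⊥-elim (c≢a c≡a)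
    ... | tri< c<a _ _ = ℕ.≤-reflexive (begin-equality
      cross f c                          ≡⟨ crossᵛ-below (f a) (f b) (f c) c<a ⟩
      𝟙 (f a F.<? f c) + 𝟙 (f b F.<? f c) ≡⟨ ℕ.+-comm (𝟙 (f a F.<? f c)) _ ⟩
      𝟙 (f b F.<? f c) + 𝟙 (f a F.<? f c) ≡⟨ crossᵛ-below (f b) (f a) (f c) c<a ⟨
      crossᵛ c (f b) (f a) (f c)          ≡⟨ cross-f′ c≢a c≢b ⟨
      cross f′ c                         ∎)
      where open ℕ.≤-Reasoning
    ... | tri> _ _ a<c with <-cmp c b
    ...   | tri≈ _ c≡b _ = ⊥-elim (c≢b c≡b)
    ...   | tri< c<b _ _ = begin
      cross f c                          ≡⟨ crossᵛ-between (f a) (f b) (f c) a<c c<b ⟩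
      𝟙 (f c F.<? f a) + 𝟙 (f b F.<? f c) ≤⟨ ℕ.+-mono-≤ (𝟙-mono (f c F.<? f a) (f c F.<? f b) (λ fc<fa → <-trans fc<fa fa<fb))
                                                     (𝟙-mono (f b F.<? f c) (f a F.<? f c) (λ fb<fc → <-trans fa<fb fb<fc)) ⟩
      𝟙 (f c F.<? f b) + 𝟙 (f a F.<? f c) ≡⟨ crossᵛ-between (f b) (f a) (f c) a<c c<b ⟨
      crossᵛ c (f b) (f a) (f c)          ≡⟨ cross-f′ c≢a c≢b ⟨
      cross f′ c                         ∎
      where open ℕ.≤-Reasoning
    ...   | tri> _ _ b<c = ℕ.≤-reflexive (begin-equality
      cross f c                          ≡⟨ crossᵛ-above (f a) (f b) (f c) b<c ⟩
      𝟙 (f c F.<? f a) + 𝟙 (f c F.<? f b) ≡⟨ ℕ.+-comm (𝟙 (f c F.<? f a)) _ ⟩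
      𝟙 (f c F.<? f b) + 𝟙 (f c F.<? f a) ≡⟨ crossᵛ-above (f b) (f a) (f c) b<c ⟨
      crossᵛ c (f b) (f a) (f c)          ≡⟨ cross-f′ c≢a c≢b ⟨
      cross f′ c                         ∎)
      where open ℕ.≤-Reasoning

    cross-blocked : ∀ {c} → a < c → c < b → f a < f c → f c < f b → cross f c + 2 ≡ cross f′ c
    cross-blocked {c} a<c c<b fa<fc fc<fb = begin
      cross f c + 2
        ≡⟨ cong (_+ 2) (crossᵛ-between (f a) (f b) (f c) a<c c<b) ⟩
      𝟙 (f c F.<? f a) + 𝟙 (f b F.<? f c) + 2
        ≡⟨ cong₂ (λ x y → x + y + 2) (𝟙-no (f c F.<? f a) (<-asym fa<fc)) (𝟙-no (f b F.<? f c) (<-asym fc<fb)) ⟩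
      2
        ≡⟨ cong₂ _+_ (𝟙-yes (f c F.<? f b) fc<fb) (𝟙-yes (f a F.<? f c) fa<fc) ⟨
      𝟙 (f c F.<? f b) + 𝟙 (f a F.<? f c)
        ≡⟨ crossᵛ-between (f b) (f a) (f c) a<c c<b ⟨
      crossᵛ c (f b) (f a) (f c)
        ≡⟨ cross-f′ (<⇒≢ a<c ∘ sym) (<⇒≢ c<b) ⟨
      cross f′ c
        ∎
      where open ≡-Reasoning

    inv-f : inv f ≡ crossSum f + inner f
    inv-f = trans (inv-split f) (cong (_+ (crossSum f + inner f)) corner-f)

    inv-f′ : inv f′ ≡ suc (crossSum f′ + inner f)
    inv-f′ = trans (inv-split f′) (cong₂ (λ x y → x + (crossSum f′ + y)) corner-f′ inner-f′)

  inv-transp-< : suc (inv f) ≤ inv (f ∘ transp a b)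
  inv-transp-< = begin
    suc (inv f)                   ≡⟨ cong suc inv-f ⟩
    suc (crossSum f + inner f)    ≤⟨ s≤s (ℕ.+-monoˡ-≤ (inner f) (sum-mono (zeroAt₂-mono b≢a cross-mono))) ⟩
    suc (crossSum f′ + inner f)   ≡⟨ inv-f′ ⟨
    inv f′                        ∎
    where open ℕ.≤-Reasoning

  inv-transp-blocked : ∀ {c} → a < c → c < b → f a < f c → f c < f b → 3 + inv f ≤ inv (f ∘ transp a b)
  inv-transp-blocked {c} a<c c<b fa<fc fc<fb = begin
    3 + inv f                         ≡⟨ cong (3 +_) inv-f ⟩
    3 + (crossSum f + inner f)        ≡⟨ cong suc (trans (cong (_+ inner f) (ℕ.+-comm (crossSum f) 2)) (ℕ.+-assoc 2 (crossSum f) (inner f))) ⟨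
    suc (crossSum f + 2 + inner f)    ≤⟨ s≤s (ℕ.+-monoˡ-≤ (inner f) crossSum-blocked) ⟩
    suc (crossSum f′ + inner f)       ≡⟨ inv-f′ ⟨
    inv f′                            ∎
    where
    open ℕ.≤-Reasoning
    c≢a : c ≢ a
    c≢a = <⇒≢ a<c ∘ sym
    c≢b : c ≢ b
    c≢b = <⇒≢ c<b
    crossSum-blocked : crossSum f + 2 ≤ crossSum f′
    crossSum-blocked = sum-mono-at c (zeroAt₂-mono b≢a cross-mono)
      (ℕ.≤-reflexive (trans (cong (_+ 2) (zeroAt₂-≢ b≢a (cross f) c≢a c≢b))
                            (trans (cross-blocked a<c c<b fa<fc fc<fb) (sym (zeroAt₂-≢ b≢a (cross f′) c≢a c≢b)))))

-- Bruhat transpositions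

module _ {n : ℕ} {σ : Fin n → Fin n} where

  bruhat⇒no-value-between : ∀ {a b c} → a < c → c < b → IsBruhat σ a b → σ a < σ c → σ c < σ b → ⊥
  bruhat⇒no-value-between a<c c<b bruhat σa<σc σc<σb =
    ℕ.m+n≮n 1 (inv σ) (ℕ.s≤s⁻¹
      (subst (3 + inv σ ≤_) bruhat (inv-transp-blocked σ (<-trans a<c c<b) (<-trans σa<σc σc<σb) a<c c<b σa<σc σc<σb)))

  bruhat⇒< : Injective _≡_ _≡_ σ → ∀ {a b} → a < b → IsBruhat σ a b → σ a < σ b
  bruhat⇒< σ-injective {a} {b} a<b bruhat with <-cmp (σ a) (σ b)
  ... | tri< σa<σb _ _ = σa<σb
  ... | tri≈ _ σa≡σb _ = ⊥-elim (<⇒≢ a<b (σ-injective σa≡σb))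
  ... | tri> _ _ σb<σa = ⊥-elim (ℕ.m+n≮n 1 (inv σ) (subst₂ _≤_ (cong suc bruhat) undo
                           (inv-transp-< (σ ∘ transp a b) a<b (subst₂ _<_ (sym σ′a) (sym σ′b) σb<σa))))
    where
    σ′a : σ (transp a b a) ≡ σ b
    σ′a = cong σ (transp-≡ˡ a b)
    σ′b : σ (transp a b b) ≡ σ a
    σ′b = cong σ (transp-≡ʳ a b)
    undo : inv (σ ∘ transp a b ∘ transp a b) ≡ inv σ
    undo = inv-cong (cong σ ∘ transp-involutive a b)

-- Cycles

module _ {n : ℕ} where

  open import Data.List.Relation.Binary.Permutation.Setoid.Properties (setoid (Fin n))
    using (Unique-resp-↭; ++-comm)
  open import Data.List.Relation.Binary.Permutation.Setoid (setoid (Fin n)) using (↭-prep)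

  cycleGo-last : ∀ (h z : Fin n) cs → All (z ≢_) cs → cycleGo h (cs ++ [ z ]) z ≡ h
  cycleGo-last h z [] [] with z ≟ z
  ... | yes _   = refl
  ... | no z≢z  = ⊥-elim (z≢z refl)
  cycleGo-last h z (c ∷ []) (z≢c ∷ []) with z ≟ c
  ... | yes z≡c = ⊥-elim (z≢c z≡c)
  ... | no _    = cycleGo-last h z [] []
  cycleGo-last h z (c ∷ d ∷ cs) (z≢c ∷ z∉cs) with z ≟ c
  ... | yes z≡c = ⊥-elim (z≢c z≡c)
  ... | no _    = cycleGo-last h z (d ∷ cs) z∉cs

  cycleGo-∷ʳ-≢ : ∀ (h z c : Fin n) cs {x} → x ≢ z → cycleGo h ((c ∷ cs) ++ [ z ]) x ≡ cycleGo z (c ∷ cs) x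
  cycleGo-∷ʳ-≢ h z c [] {x} x≢z with x ≟ c
  ... | yes _ = refl
  ... | no _  = cong (λ t → if t then h else x) (dec-false (x ≟ z) x≢z)
  cycleGo-∷ʳ-≢ h z c (d ∷ cs) {x} x≢z with x ≟ c
  ... | yes _ = refl
  ... | no _  = cycleGo-∷ʳ-≢ h z d cs x≢z

  cycle-rotate₁ : ∀ (a : Fin n) cs → All (a ≢_) cs → ∀ x → cycle (a ∷ cs) x ≡ cycle (cs ++ [ a ]) x
  cycle-rotate₁ a [] [] x = refl
  cycle-rotate₁ a (c ∷ cs) a∉c∷cs x with x ≟ a
  ... | yes refl = sym (cycleGo-last c x (c ∷ cs) a∉c∷cs)
  ... | no x≢a   = sym (cycleGo-∷ʳ-≢ c a c cs x≢a)

  cycle-rotate : ∀ xs ys → Unique (xs ++ ys) → ∀ x → cycle (xs ++ ys) x ≡ cycle (ys ++ xs) x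
  cycle-rotate [] ys _ x = cong (λ zs → cycle zs x) (sym (++-identityʳ ys))
  cycle-rotate (a ∷ xs) ys unique@(a∉xs++ys ∷ _) x = begin
    cycle (a ∷ xs ++ ys) x       ≡⟨ cycle-rotate₁ a (xs ++ ys) a∉xs++ys x ⟩
    cycle ((xs ++ ys) ++ [ a ]) x ≡⟨ cong (λ zs → cycle zs x) (++-assoc xs ys [ a ]) ⟩
    cycle (xs ++ ys ++ [ a ]) x   ≡⟨ cycle-rotate xs (ys ++ [ a ]) unique′ x ⟩
    cycle ((ys ++ [ a ]) ++ xs) x ≡⟨ cong (λ zs → cycle zs x) (++-assoc ys [ a ] xs) ⟩
    cycle (ys ++ a ∷ xs) x        ∎
    where
    open ≡-Reasoning
    unique′ : Unique (xs ++ ys ++ [ a ])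
    unique′ = subst Unique (++-assoc xs ys [ a ]) (Unique-resp-↭ (++-comm [ a ] (xs ++ ys)) unique)

  cycleGo-[_] : ∀ {h} (z : Fin n) {x} → x ≢ h → cycleGo h [ z ] x ≡ transp h z x
  cycleGo-[_] {h} z {x} x≢h = go (x ≟ z)
    where
    go : Dec (x ≡ z) → cycleGo h [ z ] x ≡ transp h z x
    go (yes refl) = trans (cong (λ t → if t then h else x) (dec-true (x ≟ x) refl)) (sym (transp-≡ʳ h x))
    go (no x≢z)   = trans (cong (λ t → if t then h else x) (dec-false (x ≟ z) x≢z)) (sym (transp-≢ h z x≢h x≢z))

  -- The hypothesis on x admits h = c, which is how cycle-∷ʳ uses this lemma.
  cycleGo-∷ʳ : ∀ (h z c : Fin n) cs {x} → All (z ≢_) (c ∷ cs) → All (h ≢_) cs → (x ≡ h → x ≡ c) →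
               cycleGo h ((c ∷ cs) ++ [ z ]) x ≡ transp h z (cycleGo h (c ∷ cs) x)
  cycleGo-∷ʳ h z c [] {x} _ [] x≡h→x≡c with x ≟ c
  ... | yes refl = sym (transp-≡ˡ h z)
  ... | no x≢c   = cycleGo-[ z ] (x≢c ∘ x≡h→x≡c)
  cycleGo-∷ʳ h z c (d ∷ cs) {x} (_ ∷ z∉d∷cs@(z≢d ∷ _)) (h≢d ∷ h∉cs) x≡h→x≡c with x ≟ c
  ... | yes refl = sym (transp-≢ h z (h≢d ∘ sym) (z≢d ∘ sym))
  ... | no x≢c   = cycleGo-∷ʳ h z d cs z∉d∷cs h∉cs (⊥-elim ∘ x≢c ∘ x≡h→x≡c)

  cycle-∷ʳ : ∀ (h : Fin n) cs z → All (h ≢_) cs → All (z ≢_) cs → h ≢ z →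
             ∀ x → cycle (h ∷ cs ++ [ z ]) x ≡ transp h z (cycle (h ∷ cs) x)
  cycle-∷ʳ h cs z h∉cs z∉cs h≢z x = cycleGo-∷ʳ h z h cs ((h≢z ∘ sym) ∷ z∉cs) h∉cs id

  cycle-transps : ∀ (h : Fin n) cs → Unique (h ∷ cs) → ∀ x → cycle (h ∷ cs) x ≡ transps (map (h ,_) (reverse cs)) x
  cycle-transps h cs unique x =
    subst (λ ds → cycle (h ∷ ds) x ≡ transps (map (h ,_) (reverse cs)) x) (reverse-involutive cs)
          (go (reverse cs) (subst (λ ds → Unique (h ∷ ds)) (sym (reverse-involutive cs)) unique))
    where
    go : ∀ rs → Unique (h ∷ reverse rs) → cycle (h ∷ reverse rs) x ≡ transps (map (h ,_) rs) x
    go [] _ with x ≟ h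
    ... | yes refl = refl
    ... | no _     = refl
    go (z ∷ rs) unique′ rewrite unfold-reverse z rs
      with Unique-resp-↭ (↭-prep h (++-comm (reverse rs) [ z ])) unique′
    ... | (h≢z ∷ h∉rs) ∷ z∉rs ∷ unique-rs =
      trans (cycle-∷ʳ h (reverse rs) z h∉rs z∉rs h≢z x) (cong (transp h z) (go rs (h∉rs ∷ unique-rs)))

  transps-cancel : ∀ (k : Fin n) xs x → transps (map (_, k) xs) (transps (map (k ,_) (reverse xs)) x) ≡ x
  transps-cancel k [] x = refl
  transps-cancel k (a ∷ xs) x
    rewrite unfold-reverse a xs | map-++ (k ,_) (reverse xs) [ a ] | transps-++ (map (k ,_) (reverse xs)) [ (k , a) ] x =
      trans (cong (transp a k) (transps-cancel k xs (transp k a x)))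
            (trans (transp-sym a k (transp k a x)) (transp-involutive k a x))

  cycle-split : ∀ (as : List (Fin n)) k bs → Unique (as ++ k ∷ bs) →
                ∀ x → transps (reverse (map (k ,_) bs)) x ≡ transps (map (_, k) as) (cycle (as ++ k ∷ bs) x)
  cycle-split as k bs unique x = sym (begin
    transps (map (_, k) as) (cycle (as ++ k ∷ bs) x)
      ≡⟨ cong (transps (map (_, k) as)) (cycle-rotate as (k ∷ bs) unique x) ⟩
    transps (map (_, k) as) (cycle (k ∷ bs ++ as) x)
      ≡⟨ cong (transps (map (_, k) as)) (cycle-transps k (bs ++ as) (Unique-resp-↭ (++-comm as (k ∷ bs)) unique) x) ⟩
    transps (map (_, k) as) (transps (map (k ,_) (reverse (bs ++ as))) x)
      ≡⟨ cong (λ ts → transps (map (_, k) as) (transps ts x))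
              (trans (cong (map (k ,_)) (reverse-++ bs as)) (map-++ (k ,_) (reverse as) (reverse bs))) ⟩
    transps (map (_, k) as) (transps (map (k ,_) (reverse as) ++ map (k ,_) (reverse bs)) x)
      ≡⟨ cong (transps (map (_, k) as)) (transps-++ (map (k ,_) (reverse as)) (map (k ,_) (reverse bs)) x) ⟩
    transps (map (_, k) as) (transps (map (k ,_) (reverse as)) (transps (map (k ,_) (reverse bs)) x))
      ≡⟨ transps-cancel k as _ ⟩
    transps (map (k ,_) (reverse bs)) x
      ≡⟨ cong (λ ts → transps ts x) (reverse-map (k ,_) bs) ⟩
    transps (reverse (map (k ,_) bs)) x ∎)
    where open ≡-Reasoning

-- Paper position k is Fin index K = k - 1, so W σ (suc (toℕ K)) holds the Bruhat pairs with
-- a ≤ K < b and W σ (toℕ K) those with a < K ≤ b.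
module EtaStep {n : ℕ} (σ : Fin n → Fin n) (σ-injective : Injective _≡_ _≡_ σ) (K : Fin n) where

  open Sorting σ σ-injective

  InW : ℕ → Pair → Set
  InW k p = IsKTransp k p × IsBruhat σ (proj₁ p) (proj₂ p)

  inW? : ∀ k → Decidable (InW k)
  inW? k p = isKTransp? k p ×-dec isBruhat? σ (proj₁ p) (proj₂ p)

  startsAtK? : Decidable (λ (p : Pair) → proj₁ p ≡ K)
  startsAtK? p = proj₁ p ≟ K

  endsAtK? : Decidable (λ (p : Pair) → proj₂ p ≡ K)
  endsAtK? p = proj₂ p ≟ K

  left? : Decidable (λ a → toℕ a ℕ.< toℕ K × IsBruhat σ a K)
  left? a = (toℕ a ℕ.<? toℕ K) ×-dec isBruhat? σ a K

  right? : Decidable (λ b → toℕ K ℕ.< toℕ b × IsBruhat σ K b)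
  right? b = (toℕ K ℕ.<? toℕ b) ×-dec isBruhat? σ K b

  As Bs : List (Fin n)
  As = filter left? (allFin n)
  Bs = filter right? (allFin n)

  σ-≢∧≯⇒< : ∀ {x y} → x ≢ y → ¬ σ y < σ x → σ x < σ y
  σ-≢∧≯⇒< {x} {y} x≢y σy≮σx with <-cmp (σ x) (σ y)
  ... | tri< σx<σy _ _ = σx<σy
  ... | tri≈ _ σx≡σy _ = ⊥-elim (x≢y (σ-injective σx≡σy))
  ... | tri> _ _ σy<σx = ⊥-elim (σy≮σx σy<σx)

  common-pairs : filter (∁? startsAtK?) (filter (inW? (suc (toℕ K))) pairs) ≡ filter (∁? endsAtK?) (filter (inW? (toℕ K)) pairs)
  common-pairs = begin
    filter (∁? startsAtK?) (filter (inW? (suc (toℕ K))) pairs)  ≡⟨ filter-filter (∁? startsAtK?) (inW? _) pairs ⟩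
    filter (∁? startsAtK? ∩? inW? (suc (toℕ K))) pairs          ≡⟨ filter-≐ _ _ (to , from) pairs ⟩
    filter (∁? endsAtK? ∩? inW? (toℕ K)) pairs                  ≡⟨ filter-filter (∁? endsAtK?) (inW? _) pairs ⟨
    filter (∁? endsAtK?) (filter (inW? (toℕ K)) pairs)          ∎
    where
    open ≡-Reasoning
    to : ∀ {p} → proj₁ p ≢ K × InW (suc (toℕ K)) p → proj₂ p ≢ K × InW (toℕ K) p
    to (a≢K , (a≤K , K<b) , bruhat) = <⇒≢ K<b ∘ sym , (≤∧≢⇒< (ℕ.s≤s⁻¹ a≤K) a≢K , ℕ.<⇒≤ K<b) , bruhat
    from : ∀ {p} → proj₂ p ≢ K × InW (toℕ K) p → proj₁ p ≢ K × InW (suc (toℕ K)) p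
    from (b≢K , (a<K , K≤b) , bruhat) = <⇒≢ a<K , (ℕ.m<n⇒m<1+n a<K , ≤∧≢⇒< K≤b (b≢K ∘ sym)) , bruhat

  pairs-from-K : filter startsAtK? (filter (inW? (suc (toℕ K))) pairs) ≡ map (K ,_) Bs
  pairs-from-K = begin
    filter startsAtK? (filter (inW? (suc (toℕ K))) pairs)     ≡⟨ filter-filter startsAtK? (inW? _) pairs ⟩
    filter (startsAtK? ∩? inW? (suc (toℕ K))) pairs           ≡⟨ filter-≐ _ _ (to , from) pairs ⟩
    filter ((_≟ K) ×? right?) pairs                           ≡⟨ filter-cartesianProduct (_≟ K) right? (allFin n) (allFin n) ⟩
    cartesianProduct (filter (_≟ K) (allFin n)) Bs            ≡⟨ cong (λ ks → cartesianProduct ks Bs) (filter-≟-allFin K) ⟩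
    cartesianProduct [ K ] Bs                                 ≡⟨ cartesianProduct-[ K ]ˡ Bs ⟩
    map (K ,_) Bs                                             ∎
    where
    open ≡-Reasoning
    to : ∀ {p} → proj₁ p ≡ K × InW (suc (toℕ K)) p → proj₁ p ≡ K × (toℕ K ℕ.< toℕ (proj₂ p) × IsBruhat σ K (proj₂ p))
    to (refl , (_ , K<b) , bruhat) = refl , K<b , bruhat
    from : ∀ {p} → proj₁ p ≡ K × (toℕ K ℕ.< toℕ (proj₂ p) × IsBruhat σ K (proj₂ p)) → proj₁ p ≡ K × InW (suc (toℕ K)) p
    from (refl , K<b , bruhat) = refl , (ℕ.n<1+n _ , K<b) , bruhat

  pairs-to-K : filter endsAtK? (filter (inW? (toℕ K)) pairs) ≡ map (_, K) As
  pairs-to-K = begin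
    filter endsAtK? (filter (inW? (toℕ K)) pairs)             ≡⟨ filter-filter endsAtK? (inW? _) pairs ⟩
    filter (endsAtK? ∩? inW? (toℕ K)) pairs                   ≡⟨ filter-≐ _ _ (to , from) pairs ⟩
    filter (left? ×? (_≟ K)) pairs                            ≡⟨ filter-cartesianProduct left? (_≟ K) (allFin n) (allFin n) ⟩
    cartesianProduct As (filter (_≟ K) (allFin n))            ≡⟨ cong (cartesianProduct As) (filter-≟-allFin K) ⟩
    cartesianProduct As [ K ]                                 ≡⟨ cartesianProduct-[ K ]ʳ As ⟩
    map (_, K) As                                             ∎
    where
    open ≡-Reasoning
    to : ∀ {p} → proj₂ p ≡ K × InW (toℕ K) p → (toℕ (proj₁ p) ℕ.< toℕ K × IsBruhat σ (proj₁ p) K) × proj₂ p ≡ K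
    to (refl , (a<K , _) , bruhat) = (a<K , bruhat) , refl
    from : ∀ {p} → (toℕ (proj₁ p) ℕ.< toℕ K × IsBruhat σ (proj₁ p) K) × proj₂ p ≡ K → proj₂ p ≡ K × InW (toℕ K) p
    from ((a<K , bruhat) , refl) = refl , (a<K , ℕ.≤-refl) , bruhat

  W⁺-commute : AllPairs (λ s t → proj₁ s ≡ K → proj₁ t ≢ K → Commute s t) (W σ (suc (toℕ K)))
  W⁺-commute = AllPairs-map-All commute (All-sort F (All.all-filter (inW? (suc (toℕ K))) pairs)) (sort-sorted F)
    where
    F : List Pair
    F = filter (inW? (suc (toℕ K))) pairs
    commute : ∀ {s t} → InW (suc (toℕ K)) s → InW (suc (toℕ K)) t → ¬ t ≺ s →
              proj₁ s ≡ K → proj₁ t ≢ K → Commute s t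
    commute {K , b} {a′ , b′} ((_ , K<b) , bruhat) ((a′≤K , K<b′) , bruhat′) t⊀s refl a′≢K =
      transp-comm K b a′ b′ (a′≢K ∘ sym) (<⇒≢ K<b′) (<⇒≢ (<-trans a′<K K<b) ∘ sym) b≢b′
      where
      a′<K : a′ < K
      a′<K = ≤∧≢⇒< (ℕ.s≤s⁻¹ a′≤K) a′≢K
      b≢b′ : b ≢ b′
      b≢b′ refl = bruhat⇒no-value-between a′<K K<b bruhat′
                    (σ-≢∧≯⇒< a′≢K (t⊀s ∘ inj₁)) (bruhat⇒< σ-injective K<b bruhat)

  W⁻-commute : AllPairs (λ s t → proj₂ s ≡ K → proj₂ t ≢ K → Commute s t) (W σ (toℕ K))
  W⁻-commute = AllPairs-map-All commute (All-sort F (All.all-filter (inW? (toℕ K)) pairs)) (sort-sorted F)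
    where
    F : List Pair
    F = filter (inW? (toℕ K)) pairs
    commute : ∀ {s t} → InW (toℕ K) s → InW (toℕ K) t → ¬ t ≺ s →
              proj₂ s ≡ K → proj₂ t ≢ K → Commute s t
    commute {a , K} {a′ , b′} ((a<K , _) , bruhat) ((a′<K , K≤b′) , bruhat′) t⊀s refl b′≢K =
      transp-comm a K a′ b′ a≢a′ (<⇒≢ (<-trans a<K K<b′)) (<⇒≢ a′<K ∘ sym) (b′≢K ∘ sym)
      where
      K<b′ : K < b′
      K<b′ = ≤∧≢⇒< K≤b′ (b′≢K ∘ sym)
      a≢a′ : a ≢ a′
      a≢a′ refl = bruhat⇒no-value-between a<K K<b′ bruhat′
                    (bruhat⇒< σ-injective a<K bruhat) (σ-≢∧≯⇒< (b′≢K ∘ sym) (λ σb′<σK → t⊀s (inj₂ (refl , σb′<σK))))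

  Bs-descending : AllPairs (λ s t → t ≺ s) (map (K ,_) Bs)
  Bs-descending = AllPairs.map⁺ (AllPairs-map-All descending (All.all-filter right? (allFin n))
                                                  (AllPairs.filter⁺ right? (AllPairs.tabulate⁺-< id)))
    where
    descending : ∀ {b b′} → toℕ K ℕ.< toℕ b × IsBruhat σ K b → toℕ K ℕ.< toℕ b′ × IsBruhat σ K b′ →
                 b < b′ → (K , b′) ≺ (K , b)
    descending (K<b , bruhat) (_ , bruhat′) b<b′ = inj₂ (refl , σ-≢∧≯⇒< (<⇒≢ b<b′ ∘ sym)
      (λ σb<σb′ → bruhat⇒no-value-between K<b b<b′ bruhat′ (bruhat⇒< σ-injective K<b bruhat) σb<σb′))

  As-ascending : AllPairs _≺_ (map (_, K) As)
  As-ascending = AllPairs.map⁺ (AllPairs-map-All ascending (All.all-filter left? (allFin n))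
                                                (AllPairs.filter⁺ left? (AllPairs.tabulate⁺-< id)))
    where
    ascending : ∀ {a a′} → toℕ a ℕ.< toℕ K × IsBruhat σ a K → toℕ a′ ℕ.< toℕ K × IsBruhat σ a′ K →
                a < a′ → (a , K) ≺ (a′ , K)
    ascending (_ , bruhat) (a′<K , bruhat′) a<a′ = inj₁ (σ-≢∧≯⇒< (<⇒≢ a<a′ ∘ sym)
      (λ σa<σa′ → bruhat⇒no-value-between a<a′ a′<K bruhat σa<σa′ (bruhat⇒< σ-injective a′<K bruhat′)))

  As-K-Bs-unique : Unique (As ++ K ∷ Bs)
  As-K-Bs-unique = AllPairs.map <⇒≢ (AllPairs.++⁺ (AllPairs.filter⁺ left? (AllPairs.tabulate⁺-< id))
    (All.map proj₁ Bs-right ∷ AllPairs.filter⁺ right? (AllPairs.tabulate⁺-< id))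
    (All.map (λ (a<K , _) → a<K ∷ All.map (λ (K<b , _) → <-trans a<K K<b) Bs-right) (All.all-filter left? (allFin n))))
    where
    Bs-right : All (λ b → toℕ K ℕ.< toℕ b × IsBruhat σ K b) Bs
    Bs-right = All.all-filter right? (allFin n)

  W-common : filter (∁? startsAtK?) (W σ (suc (toℕ K))) ≡ filter (∁? endsAtK?) (W σ (toℕ K))
  W-common = trans (filter-sort (∁? startsAtK?) (filter (inW? (suc (toℕ K))) pairs))
                    (trans (cong sort common-pairs) (sym (filter-sort (∁? endsAtK?) (filter (inW? (toℕ K)) pairs))))

  W⁺-startsAtK : filter startsAtK? (W σ (suc (toℕ K))) ≡ reverse (map (K ,_) Bs)
  W⁺-startsAtK = trans (filter-sort startsAtK? (filter (inW? (suc (toℕ K))) pairs))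
                       (trans (cong sort pairs-from-K) (sort-descending (map (K ,_) Bs) Bs-descending))

  W⁻-endsAtK : filter endsAtK? (W σ (toℕ K)) ≡ map (_, K) As
  W⁻-endsAtK = trans (filter-sort endsAtK? (filter (inW? (toℕ K)) pairs))
                     (trans (cong sort pairs-to-K) (sort-ascending (map (_, K) As) As-ascending))

proposition4p4p1 : ∀ {n} (σ : Permutation′ n) (kf : Fin n) (i : Fin n) →
    eta (σ ⟨$⟩ʳ_) (suc (toℕ kf)) i
      ≡ eta (σ ⟨$⟩ʳ_) (toℕ kf)
          (cycle (filter (λ a → (toℕ a <? toℕ kf) ×-dec isBruhat? (σ ⟨$⟩ʳ_) a kf) (allFin n)
                  ++ [ kf ]
                  ++ filter (λ b → (toℕ kf <? toℕ b) ×-dec isBruhat? (σ ⟨$⟩ʳ_) kf b) (allFin n))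
            i)
proposition4p4p1 σ K i = begin
  eta f (suc (toℕ K)) i
    ≡⟨ eta-transps f (suc (toℕ K)) i ⟩
  f (transps W⁺ i)
    ≡⟨ cong f (transps-split startsAtK? W⁺ W⁺-commute i) ⟩
  f (transps (filter (∁? startsAtK?) W⁺) (transps (filter startsAtK? W⁺) i))
    ≡⟨ cong₂ (λ ss ts → f (transps ss (transps ts i))) W-common W⁺-startsAtK ⟩
  f (transps (filter (∁? endsAtK?) W⁻) (transps (reverse (map (K ,_) Bs)) i))
    ≡⟨ cong (f ∘ transps (filter (∁? endsAtK?) W⁻)) (cycle-split As K Bs As-K-Bs-unique i) ⟩
  f (transps (filter (∁? endsAtK?) W⁻) (transps (map (_, K) As) c))
    ≡⟨ cong (λ ts → f (transps (filter (∁? endsAtK?) W⁻) (transps ts c))) W⁻-endsAtK ⟨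
  f (transps (filter (∁? endsAtK?) W⁻) (transps (filter endsAtK? W⁻) c))
    ≡⟨ cong f (transps-split endsAtK? W⁻ W⁻-commute c) ⟨
  f (transps W⁻ c)
    ≡⟨ eta-transps f (toℕ K) c ⟨
  eta f (toℕ K) c ∎
  where
  f : Fin _ → Fin _
  f = σ ⟨$⟩ʳ_
  open EtaStep f (Injection.injective (↔⇒↣ σ)) K
  open ≡-Reasoning
  W⁺ W⁻ : List (Fin _ × Fin _)
  W⁺ = W f (suc (toℕ K))
  W⁻ = W f (toℕ K)
  c : Fin _
  c = cycle (As ++ K ∷ Bs) i
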